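{- If $G$ is a $2$-connected graph, then $\mathrm{lec}(G)\leq 3$.
   Context: Graphs are finite, simple. Given an edge-colouring $\varphi:E(G)\to[1,k]$, a path is loose if it consists of exactly one edge, or of exactly two edges of different colours, or has at least three edges coloured with at least three distinct colours. $\mathrm{lec}(G)$ is the least $k$ for which there is an edge-colouring with $k$ colours such that every two distinct vertices are joined by a loose path. -}

module Defs where

open import Data.Nat using (ℕ; _≤_)
open import Data.Fin using (Fin)
open import Data.Bool using (Bool; true; false)
open import Data.List using (List; []; _∷_; length)
open import Data.List.Membership.Propositional using (_∈_; _∉_)
open import Data.List.Relation.Unary.Unique.Propositional using (Unique)
open import Data.Product using (Σ; Σ-syntax; _×_; _,_)
open import Data.Sum using (_⊎_)
open import Relation.Binary.PropositionalEquality using (_≡_; _≢_)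

record Graph (n : ℕ) : Set where
  field
    adj    : Fin n → Fin n → Bool
    adj-sym    : ∀ u v → adj u v ≡ adj v u
    adj-irrefl : ∀ u → adj u u ≡ false

open Graph public

data Walk {n : ℕ} (G : Graph n) : Fin n → Fin n → Set where
  stop : (u : Fin n) → Walk G u u
  step : ∀ {u w v} → adj G u w ≡ true → Walk G w v → Walk G u v

vertices : ∀ {n} {G : Graph n} {u v} → Walk G u v → List (Fin n)
vertices (stop u) = u ∷ []
vertices (step {u = u} _ p) = u ∷ vertices p

IsPath : ∀ {n} {G : Graph n} {u v} → Walk G u v → Set
IsPath p = Unique (vertices p)

Connected : ∀ {n} → Graph n → Set
Connected {n} G = ∀ (u v : Fin n) → Σ[ p ∈ Walk G u v ] IsPath p

ConnectedWithout : ∀ {n} → Graph n → Fin n → Set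
ConnectedWithout {n} G x =
  ∀ (u v : Fin n) → u ≢ x → v ≢ x → Σ[ p ∈ Walk G u v ] (IsPath p × x ∉ vertices p)

TwoConnected : ∀ {n} → Graph n → Set
TwoConnected {n} G = (3 ≤ n) × Connected G × (∀ x → ConnectedWithout G x)

-- An edge-colouring with colours Fin k (colour of edge uv is col u v; values on non-edges irrelevant).
record EdgeColouring {n : ℕ} (G : Graph n) (k : ℕ) : Set where
  field
    col     : Fin n → Fin n → Fin k
    col-sym : ∀ u v → col u v ≡ col v u

open EdgeColouring public

edgeColours : ∀ {n k} {G : Graph n} → EdgeColouring G k → ∀ {u v} → Walk G u v → List (Fin k)
edgeColours c (stop _) = []
edgeColours c (step {u = u} {w = w} _ p) = col c u w ∷ edgeColours c p

IsLooseColours : ∀ {k} → List (Fin k) → Set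
IsLooseColours {k} cs =
  (length cs ≡ 1)
  ⊎ (Σ[ a ∈ Fin k ] Σ[ b ∈ Fin k ] (cs ≡ a ∷ b ∷ [] × a ≢ b))
  ⊎ (3 ≤ length cs × Σ[ a ∈ Fin k ] Σ[ b ∈ Fin k ] Σ[ c ∈ Fin k ]
        (a ∈ cs × b ∈ cs × c ∈ cs × a ≢ b × a ≢ c × b ≢ c))

IsLoosePath : ∀ {n k} {G : Graph n} → EdgeColouring G k → ∀ {u v} → Walk G u v → Set
IsLoosePath c p = IsPath p × IsLooseColours (edgeColours c p)

LecAtMost : ∀ {n} → Graph n → ℕ → Set
LecAtMost {n} G k = Σ[ c ∈ EdgeColouring G k ]
  (∀ (u v : Fin n) → u ≢ v → Σ[ p ∈ Walk G u v ] IsLoosePath c p)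

{-# OPTIONS --safe #-}
-- Fix an edge xy. Colour xy with 0, the other edges at x with 1, the other edges at y with 2, and every
-- remaining edge with 2 if it meets a neighbour of x and with 1 otherwise.
-- In a 2-connected graph every vertex lies on a path from y to x: a path avoiding one vertex of such a path can
-- always be spliced into it. The same splicing joins any u, v outside {x, y} by disjoint paths u ⇝ x and y ⇝ v
-- (or u ⇝ y and x ⇝ v); through the edge xy they form a path whose edges around xy are coloured 1, 0, 2.
-- From x to a non-neighbour v: x y v, or, for the predecessor z of v on a path Q : y ⇝ v avoiding x, either x z v
-- or x followed by Q, whose last edge then has colour 1. From y: y x v, or y followed by a path x ⇝ v avoiding y.
module Submission where

open import Defs
open import Data.Bool using (Bool; true; false; _∨_)
open import Data.Bool.Properties using (∨-comm)
open import Data.Fin using (Fin; _≟_)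
open import Data.Fin.Patterns using (0F; 1F; 2F)
open import Data.List using (List; []; _∷_; _++_; [_]; reverse; length)
open import Data.List.Properties using (unfold-reverse; length-reverse; length-removeAt′)
open import Data.List.Membership.Propositional using (_∈_; _∉_; _─_)
open import Data.List.Membership.Propositional.Properties using (∈-++⁺ˡ; ∈-++⁺ʳ; ∈-++⁻)
open import Data.List.Relation.Binary.Disjoint.Propositional using (Disjoint)
open import Data.List.Relation.Binary.Subset.Propositional using (_⊆_)
open import Data.List.Relation.Unary.All as All using ([]; _∷_)
open import Data.List.Relation.Unary.All.Properties using (¬Any⇒All¬; All¬⇒¬Any; ++⁻ˡ)
open import Data.List.Relation.Unary.AllPairs using ([]; _∷_)
open import Data.List.Relation.Unary.Any using (here; there; index; any?)
open import Data.List.Relation.Unary.Any.Properties using (reverse⁺; reverse⁻)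
open import Data.List.Relation.Unary.Unique.Propositional using (Unique)
open import Data.List.Relation.Unary.Unique.Propositional.Properties using (++⁺; Unique[x∷xs]⇒x∉xs)
open import Data.Nat using (ℕ; suc; _≤_; z≤n; s≤s)
open import Data.Nat.Properties using (module ≤-Reasoning)
open import Data.Product using (Σ-syntax; _×_; _,_; proj₁; proj₂)
open import Data.Sum using (_⊎_; inj₁; inj₂; [_,_]′)
open import Function using (_∘_; id)
open import Relation.Nullary using (yes; no; contradiction)
open import Relation.Nullary.Decidable using (does; dec-true; dec-false)
open import Relation.Binary.PropositionalEquality hiding ([_])

module _ {A : Set} where

  private
    variable
      a d : A
      xs ys zs ws : List A

  Unique-∷⁺ : a ∉ xs → Unique xs → Unique (a ∷ xs)
  Unique-∷⁺ {xs = xs} a∉xs xs! = ¬Any⇒All¬ xs a∉xs ∷ xs!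

  Unique-++⁻ : ∀ xs → Unique (xs ++ ys) → Unique xs × Unique ys × Disjoint xs ys
  Unique-++⁻ [] ys! = [] , ys! , λ ()
  Unique-++⁻ {ys = ys} (x ∷ xs) (x∉ ∷ xs++ys!) with Unique-++⁻ xs xs++ys!
  ... | xs! , ys! , xs#ys = ++⁻ˡ xs x∉ ∷ xs! , ys! , x∷xs#ys
    where
    x∷xs#ys : Disjoint (x ∷ xs) ys
    x∷xs#ys (here refl , v∈ys) = All.lookup x∉ (∈-++⁺ʳ xs v∈ys) refl
    x∷xs#ys (there v∈xs , v∈ys) = xs#ys (v∈xs , v∈ys)

  Unique-reverse⁺ : Unique xs → Unique (reverse xs)
  Unique-reverse⁺ {[]} [] = []
  Unique-reverse⁺ {x ∷ xs} (x∉xs ∷ xs!) rewrite unfold-reverse x xs =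
    ++⁺ (Unique-reverse⁺ xs!) ([] ∷ []) λ { (x∈ , here refl) → All¬⇒¬Any x∉xs (reverse⁻ x∈) }

  Disjoint-⊆ : xs ⊆ ys → zs ⊆ ws → Disjoint ys ws → Disjoint xs zs
  Disjoint-⊆ xs⊆ys zs⊆ws ys#ws (v∈xs , v∈zs) = ys#ws (xs⊆ys v∈xs , zs⊆ws v∈zs)

  ∈-─⁺ : (d∈xs : d ∈ xs) → a ∈ xs → a ≢ d → a ∈ xs ─ d∈xs
  ∈-─⁺ (here refl) (here refl) a≢d = contradiction refl a≢d
  ∈-─⁺ (here _) (there a∈xs) _ = a∈xs
  ∈-─⁺ (there _) (here refl) _ = here refl
  ∈-─⁺ (there d∈xs) (there a∈xs) a≢d = there (∈-─⁺ d∈xs a∈xs a≢d)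

  unique⇒length≤ : Unique ys → ys ⊆ xs → length ys ≤ length xs
  unique⇒length≤ [] _ = z≤n
  unique⇒length≤ {d ∷ ds} {xs} (d∉ds ∷ ds!) ds⊆xs = begin
    suc (length ds)          ≤⟨ s≤s (unique⇒length≤ ds! ds⊆xs─d) ⟩
    suc (length (xs ─ d∈xs)) ≡⟨ sym (length-removeAt′ xs (index d∈xs)) ⟩
    length xs                ∎
    where
    open ≤-Reasoning
    d∈xs : d ∈ xs
    d∈xs = ds⊆xs (here refl)
    ds⊆xs─d : ds ⊆ xs ─ d∈xs
    ds⊆xs─d a∈ds = ∈-─⁺ d∈xs (ds⊆xs (there a∈ds)) (≢-sym (All.lookup d∉ds a∈ds))

IsLooseColours-distinct : ∀ {k} {cs : List (Fin k)} {a b c} → a ∈ cs → b ∈ cs → c ∈ cs →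
                          a ≢ b → a ≢ c → b ≢ c → IsLooseColours cs
IsLooseColours-distinct {cs = cs} {a} {b} {c} a∈ b∈ c∈ a≢b a≢c b≢c =
  inj₂ (inj₂ (unique⇒length≤ abc! abc⊆ , a , b , c , a∈ , b∈ , c∈ , a≢b , a≢c , b≢c))
  where
  abc! : Unique (a ∷ b ∷ c ∷ [])
  abc! = (a≢b ∷ a≢c ∷ []) ∷ (b≢c ∷ []) ∷ [] ∷ []
  abc⊆ : a ∷ b ∷ c ∷ [] ⊆ cs
  abc⊆ (here refl) = a∈
  abc⊆ (there (here refl)) = b∈
  abc⊆ (there (there (here refl))) = c∈

IsLooseColours-reverse : ∀ {k} {cs : List (Fin k)} → IsLooseColours cs → IsLooseColours (reverse cs)
IsLooseColours-reverse {cs = cs} (inj₁ one) = inj₁ (trans (length-reverse cs) one)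
IsLooseColours-reverse (inj₂ (inj₁ (a , b , refl , a≢b))) = inj₂ (inj₁ (b , a , refl , ≢-sym a≢b))
IsLooseColours-reverse {cs = cs} (inj₂ (inj₂ (3≤ , a , b , c , a∈ , b∈ , c∈ , a≢b , a≢c , b≢c))) =
  inj₂ (inj₂ (subst (3 ≤_) (sym (length-reverse cs)) 3≤ , a , b , c ,
              reverse⁺ a∈ , reverse⁺ b∈ , reverse⁺ c∈ , a≢b , a≢c , b≢c))

module Walks {n : ℕ} (G : Graph n) where

  private
    variable
      a s t u v w z : Fin n

  edge-sym : adj G u v ≡ true → adj G v u ≡ true
  edge-sym {u} {v} u~v = trans (adj-sym G v u) u~v

  edge⇒≢ : adj G u v ≡ true → u ≢ v
  edge⇒≢ {u} u~u refl with trans (sym u~u) (adj-irrefl G u)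
  ... | ()

  neighbour : Walk G u v → u ≢ v → Σ[ w ∈ Fin n ] adj G u w ≡ true
  neighbour (stop _) u≢u = contradiction refl u≢u
  neighbour (step u~w _) _ = _ , u~w

  infixr 5 _++ᵂ_

  _++ᵂ_ : Walk G u w → Walk G w v → Walk G u v
  stop _ ++ᵂ q = q
  step e p ++ᵂ q = step e (p ++ᵂ q)

  reverseᵂ : Walk G u v → Walk G v u
  reverseᵂ (stop u) = stop u
  reverseᵂ (step e p) = reverseᵂ p ++ᵂ step (edge-sym e) (stop _)

  initVertices : Walk G u v → List (Fin n)
  initVertices (stop _) = []
  initVertices (step {u = u} _ p) = u ∷ initVertices p

  ++ᵂ-identityʳ : (p : Walk G u v) → p ++ᵂ stop v ≡ p
  ++ᵂ-identityʳ (stop _) = refl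
  ++ᵂ-identityʳ (step e p) = cong (step e) (++ᵂ-identityʳ p)

  ++ᵂ-assoc : (p : Walk G s u) (q : Walk G u w) (r : Walk G w t) → (p ++ᵂ q) ++ᵂ r ≡ p ++ᵂ q ++ᵂ r
  ++ᵂ-assoc (stop _) q r = refl
  ++ᵂ-assoc (step e p) q r = cong (step e) (++ᵂ-assoc p q r)

  reverseᵂ-++ᵂ : (p : Walk G u w) (q : Walk G w v) → reverseᵂ (p ++ᵂ q) ≡ reverseᵂ q ++ᵂ reverseᵂ p
  reverseᵂ-++ᵂ (stop _) q = sym (++ᵂ-identityʳ (reverseᵂ q))
  reverseᵂ-++ᵂ (step e p) q = begin
    reverseᵂ (p ++ᵂ q) ++ᵂ step _ (stop _)           ≡⟨ cong (_++ᵂ step _ (stop _)) (reverseᵂ-++ᵂ p q) ⟩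
    (reverseᵂ q ++ᵂ reverseᵂ p) ++ᵂ step _ (stop _) ≡⟨ ++ᵂ-assoc (reverseᵂ q) (reverseᵂ p) _ ⟩
    reverseᵂ q ++ᵂ reverseᵂ p ++ᵂ step _ (stop _)   ∎
    where open ≡-Reasoning

  vertices-++ᵂ : (p : Walk G u w) (q : Walk G w v) → vertices (p ++ᵂ q) ≡ initVertices p ++ vertices q
  vertices-++ᵂ (stop _) q = refl
  vertices-++ᵂ (step e p) q = cong (_ ∷_) (vertices-++ᵂ p q)

  vertices-++ᵂ-step : (p : Walk G u w) (e : adj G w z ≡ true) (q : Walk G z v) →
                      vertices (p ++ᵂ step e q) ≡ vertices p ++ vertices q
  vertices-++ᵂ-step (stop _) e q = refl
  vertices-++ᵂ-step (step e′ p) e q = cong (_ ∷_) (vertices-++ᵂ-step p e q)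

  vertices-reverseᵂ : (p : Walk G u v) → vertices (reverseᵂ p) ≡ reverse (vertices p)
  vertices-reverseᵂ (stop _) = refl
  vertices-reverseᵂ (step {u = u} e p) = begin
    vertices (reverseᵂ p ++ᵂ step _ (stop u)) ≡⟨ vertices-++ᵂ-step (reverseᵂ p) _ (stop u) ⟩
    vertices (reverseᵂ p) ++ [ u ]            ≡⟨ cong (_++ [ u ]) (vertices-reverseᵂ p) ⟩
    reverse (vertices p) ++ [ u ]             ≡⟨ unfold-reverse u (vertices p) ⟨
    reverse (u ∷ vertices p)                  ∎
    where open ≡-Reasoning

  edgeColours-++ᵂ : ∀ {k} (c : EdgeColouring G k) (p : Walk G u w) (q : Walk G w v) →
                    edgeColours c (p ++ᵂ q) ≡ edgeColours c p ++ edgeColours c q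
  edgeColours-++ᵂ c (stop _) q = refl
  edgeColours-++ᵂ c (step e p) q = cong (_ ∷_) (edgeColours-++ᵂ c p q)

  edgeColours-reverseᵂ : ∀ {k} (c : EdgeColouring G k) (p : Walk G u v) →
                         edgeColours c (reverseᵂ p) ≡ reverse (edgeColours c p)
  edgeColours-reverseᵂ c (stop _) = refl
  edgeColours-reverseᵂ c (step {u = u} {w = w} e p) = begin
    edgeColours c (reverseᵂ p ++ᵂ step _ (stop u))  ≡⟨ edgeColours-++ᵂ c (reverseᵂ p) _ ⟩
    edgeColours c (reverseᵂ p) ++ [ col c w u ]     ≡⟨ cong₂ (λ cs γ → cs ++ [ γ ]) (edgeColours-reverseᵂ c p) (col-sym c w u) ⟩
    reverse (edgeColours c p) ++ [ col c u w ]      ≡⟨ unfold-reverse (col c u w) (edgeColours c p) ⟨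
    reverse (col c u w ∷ edgeColours c p)           ∎
    where open ≡-Reasoning

  vertices-initVertices : (p : Walk G u v) → vertices p ≡ initVertices p ++ [ v ]
  vertices-initVertices (stop _) = refl
  vertices-initVertices (step _ p) = cong (_ ∷_) (vertices-initVertices p)

  start∈vertices : (p : Walk G u v) → u ∈ vertices p
  start∈vertices (stop _) = here refl
  start∈vertices (step _ _) = here refl

  end∈vertices : (p : Walk G u v) → v ∈ vertices p
  end∈vertices (stop _) = here refl
  end∈vertices (step _ p) = there (end∈vertices p)

  initVertices⊆vertices : (p : Walk G u v) → initVertices p ⊆ vertices p
  initVertices⊆vertices (step _ p) (here refl) = here refl
  initVertices⊆vertices (step _ p) (there a∈) = there (initVertices⊆vertices p a∈)

  start∈initVertices : (p : Walk G u v) → u ≢ v → u ∈ initVertices p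
  start∈initVertices (stop _) u≢u = contradiction refl u≢u
  start∈initVertices (step _ _) _ = here refl

  ∈-++ᵂ⁻ : (p : Walk G u w) (q : Walk G w v) → a ∈ vertices (p ++ᵂ q) → a ∈ initVertices p ⊎ a ∈ vertices q
  ∈-++ᵂ⁻ p q a∈ = ∈-++⁻ (initVertices p) (subst (_ ∈_) (vertices-++ᵂ p q) a∈)

  ⊆-++ᵂʳ : (p : Walk G u w) {q : Walk G w v} → vertices q ⊆ vertices (p ++ᵂ q)
  ⊆-++ᵂʳ (stop _) a∈ = a∈
  ⊆-++ᵂʳ (step _ p) a∈ = there (⊆-++ᵂʳ p a∈)

  ⊆-++ᵂˡ : (p : Walk G u w) {q : Walk G w v} → vertices p ⊆ vertices (p ++ᵂ q)
  ⊆-++ᵂˡ (stop _) {q} (here refl) = start∈vertices q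
  ⊆-++ᵂˡ (step _ p) (here refl) = here refl
  ⊆-++ᵂˡ (step _ p) (there a∈) = there (⊆-++ᵂˡ p a∈)

  ∈-reverseᵂ⁺ : (p : Walk G u v) → a ∈ vertices p → a ∈ vertices (reverseᵂ p)
  ∈-reverseᵂ⁺ p a∈ = subst (_ ∈_) (sym (vertices-reverseᵂ p)) (reverse⁺ a∈)

  ∈-reverseᵂ⁻ : (p : Walk G u v) → a ∈ vertices (reverseᵂ p) → a ∈ vertices p
  ∈-reverseᵂ⁻ p a∈ = reverse⁻ (subst (_ ∈_) (vertices-reverseᵂ p) a∈)

  splitAt : (p : Walk G u v) → z ∈ vertices p → Σ[ p₁ ∈ Walk G u z ] Σ[ p₂ ∈ Walk G z v ] p ≡ p₁ ++ᵂ p₂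
  splitAt (stop u) (here refl) = stop u , stop u , refl
  splitAt (step e p) (here refl) = stop _ , step e p , refl
  splitAt (step e p) (there z∈p) with splitAt p z∈p
  ... | p₁ , p₂ , refl = step e p₁ , p₂ , refl

  firstHit : (S : List (Fin n)) (p : Walk G u v) → v ∈ S →
             Σ[ z ∈ Fin n ] z ∈ S × Σ[ p₁ ∈ Walk G u z ] Σ[ p₂ ∈ Walk G z v ]
               p ≡ p₁ ++ᵂ p₂ × Disjoint (initVertices p₁) S
  firstHit S (stop u) u∈S = u , u∈S , stop u , stop u , refl , λ ()
  firstHit S (step {u = u} e p) v∈S with any? (u ≟_) S
  ... | yes u∈S = u , u∈S , stop u , step e p , refl , λ ()
  ... | no u∉S with firstHit S p v∈S
  ...   | z , z∈S , p₁ , p₂ , refl , p₁#S = z , z∈S , step e p₁ , p₂ , refl , λ where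
    (here refl , u∈S) → u∉S u∈S
    (there a∈p₁ , a∈S) → p₁#S (a∈p₁ , a∈S)

  IsPath-++ᵂ⁻ : (p : Walk G u w) (q : Walk G w v) → IsPath (p ++ᵂ q) →
                Unique (initVertices p) × IsPath q × Disjoint (initVertices p) (vertices q)
  IsPath-++ᵂ⁻ p q pq! = Unique-++⁻ (initVertices p) (subst Unique (vertices-++ᵂ p q) pq!)

  IsPath-++ᵂ⁻ˡ : (p : Walk G u w) (q : Walk G w v) → IsPath (p ++ᵂ q) → IsPath p
  IsPath-++ᵂ⁻ˡ p q pq! with IsPath-++ᵂ⁻ p q pq!
  ... | init! , _ , init#q = subst Unique (sym (vertices-initVertices p))
          (++⁺ init! ([] ∷ []) λ { (a∈ , here refl) → init#q (a∈ , start∈vertices q) })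

  IsPath-++ᵂ⁻ʳ : (p : Walk G u w) (q : Walk G w v) → IsPath (p ++ᵂ q) → IsPath q
  IsPath-++ᵂ⁻ʳ p q pq! = proj₁ (proj₂ (IsPath-++ᵂ⁻ p q pq!))

  IsPath-++ᵂ⁺ : (p : Walk G u w) (q : Walk G w v) → Unique (initVertices p) → IsPath q →
                Disjoint (initVertices p) (vertices q) → IsPath (p ++ᵂ q)
  IsPath-++ᵂ⁺ p q init! q! init#q = subst Unique (sym (vertices-++ᵂ p q)) (++⁺ init! q! init#q)

  IsPath-initVertices : (p : Walk G u v) → IsPath p → Unique (initVertices p)
  IsPath-initVertices p p! = proj₁ (Unique-++⁻ (initVertices p) (subst Unique (vertices-initVertices p) p!))

  IsPath-reverseᵂ : (p : Walk G u v) → IsPath p → IsPath (reverseᵂ p)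
  IsPath-reverseᵂ p p! = subst Unique (sym (vertices-reverseᵂ p)) (Unique-reverse⁺ p!)

  IsPath-step : (e : adj G u w ≡ true) (p : Walk G w v) → u ∉ vertices p → IsPath p → IsPath (step e p)
  IsPath-step _ _ = Unique-∷⁺

  outer-disjoint : (p : Walk G s u) (q : Walk G u w) (r : Walk G w t) → u ≢ w →
                   IsPath (p ++ᵂ q ++ᵂ r) → Disjoint (vertices p) (vertices r)
  outer-disjoint p q r u≢w pqr! (a∈p , a∈r) with IsPath-++ᵂ⁻ p (q ++ᵂ r) pqr!
  ... | _ , qr! , initp#qr with ∈-++⁻ (initVertices p) (subst (_ ∈_) (vertices-initVertices p) a∈p)
  ...   | inj₁ a∈initp = initp#qr (a∈initp , ⊆-++ᵂʳ q a∈r)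
  ...   | inj₂ (here refl) = proj₂ (proj₂ (IsPath-++ᵂ⁻ q r qr!)) (start∈initVertices q u≢w , a∈r)

  record DisjointPaths (a b c d : Fin n) : Set where
    constructor disjointPaths
    field
      left         : Walk G a b
      right        : Walk G c d
      left-isPath  : IsPath left
      right-isPath : IsPath right
      disjoint     : Disjoint (vertices left) (vertices right)

  open DisjointPaths

  swapᴰ : ∀ {a b c d} → DisjointPaths a b c d → DisjointPaths c d a b
  swapᴰ (disjointPaths A B A! B! A#B) = disjointPaths B A B! A! (λ (v∈B , v∈A) → A#B (v∈A , v∈B))

  reverseᴰ : ∀ {a b c d} → DisjointPaths a b c d → DisjointPaths b a d c
  reverseᴰ (disjointPaths A B A! B! A#B) =
    disjointPaths (reverseᵂ A) (reverseᵂ B) (IsPath-reverseᵂ A A!) (IsPath-reverseᵂ B B!)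
      (Disjoint-⊆ (∈-reverseᵂ⁻ A) (∈-reverseᵂ⁻ B) A#B)

  linkᴰ : ∀ {a b c d} → DisjointPaths a b c d → adj G b c ≡ true → Walk G a d
  linkᴰ D b~c = left D ++ᵂ step b~c (right D)

  vertices-linkᴰ : ∀ {a b c d} (D : DisjointPaths a b c d) (b~c : adj G b c ≡ true) →
                   vertices (linkᴰ D b~c) ≡ vertices (left D) ++ vertices (right D)
  vertices-linkᴰ D b~c = vertices-++ᵂ-step (left D) b~c (right D)

  linkᴰ-isPath : ∀ {a b c d} (D : DisjointPaths a b c d) (b~c : adj G b c ≡ true) → IsPath (linkᴰ D b~c)
  linkᴰ-isPath D b~c = subst Unique (sym (vertices-linkᴰ D b~c)) (++⁺ (left-isPath D) (right-isPath D) (disjoint D))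

  otherEndpoint : s ≢ t → (D : Walk G s t) → ∀ w → Σ[ r ∈ Fin n ] r ≢ w × r ∈ vertices D
  otherEndpoint {s} {t} s≢t D w with s ≟ w
  ... | yes refl = t , ≢-sym s≢t , end∈vertices D
  ... | no s≢w = s , s≢w , start∈vertices D

  -- P followed by the rest of D₂ from z avoids D₁: P meets D only at z, which lies strictly beyond the joint a.
  detour : (D₁ : Walk G s a) (D₂ : Walk G a t) → IsPath (D₁ ++ᵂ D₂) →
           (P : Walk G v z) → IsPath P → z ∈ vertices D₂ → z ≢ a →
           Disjoint (initVertices P) (vertices (D₁ ++ᵂ D₂)) → DisjointPaths s a v t
  detour D₁ D₂ D! P P! z∈D₂ z≢a P#D with splitAt D₂ z∈D₂
  ... | D₂₁ , D₂₂ , refl = disjointPaths D₁ (P ++ᵂ D₂₂) D₁! PD₂₂! D₁#PD₂₂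
    where
    D₁! : IsPath D₁
    D₁! = IsPath-++ᵂ⁻ˡ D₁ (D₂₁ ++ᵂ D₂₂) D!
    D₂₂⊆D : vertices D₂₂ ⊆ vertices (D₁ ++ᵂ D₂₁ ++ᵂ D₂₂)
    D₂₂⊆D = ⊆-++ᵂʳ D₁ ∘ ⊆-++ᵂʳ D₂₁
    D₂₂! : IsPath D₂₂
    D₂₂! = IsPath-++ᵂ⁻ʳ D₂₁ D₂₂ (IsPath-++ᵂ⁻ʳ D₁ (D₂₁ ++ᵂ D₂₂) D!)
    PD₂₂! : IsPath (P ++ᵂ D₂₂)
    PD₂₂! = IsPath-++ᵂ⁺ P D₂₂ (IsPath-initVertices P P!) D₂₂! (Disjoint-⊆ id D₂₂⊆D P#D)
    D₁#PD₂₂ : Disjoint (vertices D₁) (vertices (P ++ᵂ D₂₂))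
    D₁#PD₂₂ (b∈D₁ , b∈PD₂₂) with ∈-++ᵂ⁻ P D₂₂ b∈PD₂₂
    ... | inj₁ b∈P = P#D (b∈P , ⊆-++ᵂˡ D₁ b∈D₁)
    ... | inj₂ b∈D₂₂ = outer-disjoint D₁ D₂₁ D₂₂ (≢-sym z≢a) D! (b∈D₁ , b∈D₂₂)

  -- Follow P up to its first vertex z on D; the side of a on which z lies decides the two disjoint paths.
  -- A detour landing before a is a detour beyond a on the reversed path.
  reroute : (D : Walk G s t) → IsPath D → a ∈ vertices D →
            (P : Walk G v w) → IsPath P → w ∈ vertices D → a ∉ vertices P →
            DisjointPaths s v a t ⊎ DisjointPaths s a v t
  reroute {s = s} {t = t} {a = a} {v = v} D D! a∈D P P! w∈D a∉P with firstHit (vertices D) P w∈D | splitAt D a∈D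
  ... | z , z∈D , P₁ , P₂ , refl , P₁#D | D₁ , D₂ , refl = [ beforeJoint , beyondJoint ]′ (∈-++ᵂ⁻ D₁ D₂ z∈D)
    where
    P₁! : IsPath P₁
    P₁! = IsPath-++ᵂ⁻ˡ P₁ P₂ P!
    z≢a : z ≢ a
    z≢a refl = a∉P (⊆-++ᵂˡ P₁ (end∈vertices P₁))
    beyondJoint : z ∈ vertices D₂ → DisjointPaths s v a t ⊎ DisjointPaths s a v t
    beyondJoint z∈D₂ = inj₂ (detour D₁ D₂ D! P₁ P₁! z∈D₂ z≢a P₁#D)
    D⁻¹≡ : reverseᵂ (D₁ ++ᵂ D₂) ≡ reverseᵂ D₂ ++ᵂ reverseᵂ D₁
    D⁻¹≡ = reverseᵂ-++ᵂ D₁ D₂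
    D⁻¹! : IsPath (reverseᵂ D₂ ++ᵂ reverseᵂ D₁)
    D⁻¹! = subst IsPath D⁻¹≡ (IsPath-reverseᵂ (D₁ ++ᵂ D₂) D!)
    P₁#D⁻¹ : Disjoint (initVertices P₁) (vertices (reverseᵂ D₂ ++ᵂ reverseᵂ D₁))
    P₁#D⁻¹ = Disjoint-⊆ id (∈-reverseᵂ⁻ (D₁ ++ᵂ D₂) ∘ subst (λ W → _ ∈ vertices W) (sym D⁻¹≡)) P₁#D
    beforeJoint : z ∈ initVertices D₁ → DisjointPaths s v a t ⊎ DisjointPaths s a v t
    beforeJoint z∈D₁ = inj₁ (swapᴰ (reverseᴰ (detour (reverseᵂ D₂) (reverseᵂ D₁) D⁻¹! P₁ P₁!
                         (∈-reverseᵂ⁺ D₁ (initVertices⊆vertices D₁ z∈D₁)) z≢a P₁#D⁻¹)))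

module TwoConnectedness {n : ℕ} {G : Graph n} (connected : Connected G)
                        (noCutVertex : ∀ w → ConnectedWithout G w) where

  open Walks G

  private
    variable
      s t u v w : Fin n

  PathThrough : Fin n → Fin n → Fin n → Set
  PathThrough s t v = Σ[ D ∈ Walk G s t ] IsPath D × v ∈ vertices D

  pathThrough-step : s ≢ t → PathThrough s t w → adj G w v ≡ true → PathThrough s t v
  pathThrough-step {w = w} {v = v} s≢t (D , D! , w∈D) w~v with otherEndpoint s≢t D w
  ... | r , r≢w , r∈D with noCutVertex w v r (≢-sym (edge⇒≢ w~v)) r≢w
  ...   | P , P! , w∉P with reroute D D! w∈D P P! r∈D w∉P
  ...     | inj₁ D′ = linkᴰ D′ (edge-sym w~v) , linkᴰ-isPath D′ (edge-sym w~v) ,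
                     subst (v ∈_) (sym (vertices-linkᴰ D′ (edge-sym w~v))) (∈-++⁺ˡ (end∈vertices (DisjointPaths.left D′)))
  ...     | inj₂ D′ = linkᴰ D′ w~v , linkᴰ-isPath D′ w~v ,
                     subst (v ∈_) (sym (vertices-linkᴰ D′ w~v)) (∈-++⁺ʳ _ (start∈vertices (DisjointPaths.right D′)))

  pathThrough-walk : s ≢ t → PathThrough s t w → Walk G w v → PathThrough s t v
  pathThrough-walk _ T (stop _) = T
  pathThrough-walk s≢t T (step e p) = pathThrough-walk s≢t (pathThrough-step s≢t T e) p

  pathThrough : s ≢ t → ∀ v → PathThrough s t v
  pathThrough {s} {t} s≢t v with connected s t
  ... | D , D! = pathThrough-walk s≢t (D , D! , end∈vertices D) (proj₁ (connected t v))

  twoDisjointPaths : s ≢ t → u ≢ t → v ≢ u → DisjointPaths u t s v ⊎ DisjointPaths u s t v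
  twoDisjointPaths {t = t} {u = u} {v = v} s≢t u≢t v≢u with pathThrough s≢t u
  ... | D , D! , u∈D with noCutVertex u v t v≢u (≢-sym u≢t)
  ...   | P , P! , u∉P with reroute D D! u∈D P P! (end∈vertices D) u∉P
  ...     | inj₁ D′ = inj₁ (swapᴰ D′)
  ...     | inj₂ D′ = inj₂ (reverseᴰ D′)

module LoosePaths {n : ℕ} {G : Graph n} {k : ℕ} (c : EdgeColouring G k) where

  open Walks G

  private
    variable
      a b u v w : Fin n

  LoosePath : Fin n → Fin n → Set
  LoosePath u v = Σ[ p ∈ Walk G u v ] IsLoosePath c p

  loosePath-edge : adj G u v ≡ true → LoosePath u v
  loosePath-edge u~v =
    step u~v (stop _) , IsPath-step u~v (stop _) (λ { (here u≡v) → edge⇒≢ u~v u≡v }) ([] ∷ []) , inj₁ refl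

  loosePath-twoEdges : adj G u w ≡ true → adj G w v ≡ true → u ≢ v → col c u w ≢ col c w v → LoosePath u v
  loosePath-twoEdges u~w w~v u≢v uw≢wv =
    step u~w (step w~v (stop _)) ,
    IsPath-step u~w (step w~v (stop _)) (λ { (here u≡w) → edge⇒≢ u~w u≡w ; (there (here u≡v)) → u≢v u≡v })
      (IsPath-step w~v (stop _) (λ { (here w≡v) → edge⇒≢ w~v w≡v }) ([] ∷ [])) ,
    inj₂ (inj₁ (_ , _ , refl , uw≢wv))

  loosePath-reverse : LoosePath u v → LoosePath v u
  loosePath-reverse (p , p! , p-loose) =
    reverseᵂ p , IsPath-reverseᵂ p p! ,
    subst IsLooseColours (sym (edgeColours-reverseᵂ c p)) (IsLooseColours-reverse p-loose)

  lastEdge : (e : adj G u w ≡ true) (p : Walk G w v) →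
             Σ[ z ∈ Fin n ] adj G z v ≡ true × z ∈ vertices (step e p) × col c z v ∈ edgeColours c (step e p)
  lastEdge {u} e (stop _) = u , e , here refl , here refl
  lastEdge e (step e′ p) with lastEdge e′ p
  ... | z , z~v , z∈p , zv∈p = z , z~v , there z∈p , there zv∈p

  RainbowThrough : Fin n → Fin n → Set
  RainbowThrough a b = ∀ {p q} → p ≢ a → p ≢ b → q ≢ a → q ≢ b →
                       col c p a ≢ col c a b × col c p a ≢ col c b q × col c a b ≢ col c b q

  loosePath-link : (D : DisjointPaths u a b v) (a~b : adj G a b ≡ true) → u ≢ a → v ≢ b →
                   RainbowThrough a b → LoosePath u v
  loosePath-link (disjointPaths (stop _) _ _ _ _) _ u≢a _ _ = contradiction refl u≢a
  loosePath-link (disjointPaths _ (stop _) _ _ _) _ _ v≢b _ = contradiction refl v≢b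
  loosePath-link {a = a} {b = b} D@(disjointPaths A@(step u~w A′) B@(step {w = q} b~q B′) _ _ A#B) a~b _ _ rainbow
    with lastEdge u~w A′
  ... | p , p~a , p∈A , pa∈A = linkᴰ D a~b , linkᴰ-isPath D a~b , subst IsLooseColours (sym colours≡) loose
    where
    colours≡ : edgeColours c (linkᴰ D a~b) ≡ edgeColours c A ++ col c a b ∷ col c b q ∷ edgeColours c B′
    colours≡ = edgeColours-++ᵂ c A (step a~b B)
    p≢b : p ≢ b
    p≢b refl = A#B (p∈A , start∈vertices B)
    q≢a : q ≢ a
    q≢a refl = A#B (end∈vertices A , there (start∈vertices B′))
    loose : IsLooseColours (edgeColours c A ++ col c a b ∷ col c b q ∷ edgeColours c B′)
    loose with rainbow (edge⇒≢ p~a) p≢b q≢a (≢-sym (edge⇒≢ b~q))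
    ... | pa≢ab , pa≢bq , ab≢bq = IsLooseColours-distinct (∈-++⁺ˡ pa∈A) (∈-++⁺ʳ (edgeColours c A) (here refl))
                                    (∈-++⁺ʳ (edgeColours c A) (there (here refl))) pa≢ab pa≢bq ab≢bq

module Tricolouring {n : ℕ} (G : Graph n) {x y : Fin n} (x~y : adj G x y ≡ true) where

  open Walks G

  private
    variable
      p q : Fin n

  x≢y : x ≢ y
  x≢y = edge⇒≢ x~y

  isX isY : Fin n → Bool
  isX a = does (a ≟ x)
  isY a = does (a ≟ y)

  tricolour : (meetsX meetsY meetsNeighbourOfX : Bool) → Fin 3
  tricolour true  true  _     = 0F
  tricolour true  false _     = 1F
  tricolour false true  _     = 2F
  tricolour false false true  = 2F
  tricolour false false false = 1F

  colour : Fin n → Fin n → Fin 3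
  colour a b = tricolour (isX a ∨ isX b) (isY a ∨ isY b) (adj G x a ∨ adj G x b)

  colour-sym : ∀ a b → colour a b ≡ colour b a
  colour-sym a b rewrite ∨-comm (isX a) (isX b) | ∨-comm (isY a) (isY b) | ∨-comm (adj G x a) (adj G x b) = refl

  colouring : EdgeColouring G 3
  colouring = record { col = colour ; col-sym = colour-sym }

  isX-x : isX x ≡ true
  isX-x = dec-true (x ≟ x) refl

  isY-y : isY y ≡ true
  isY-y = dec-true (y ≟ y) refl

  isX-≢ : p ≢ x → isX p ≡ false
  isX-≢ = dec-false (_ ≟ x)

  isY-≢ : p ≢ y → isY p ≡ false
  isY-≢ = dec-false (_ ≟ y)

  colour-xy : colour x y ≡ 0F
  colour-xy rewrite isX-x | isY-≢ x≢y | isY-y = refl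

  colour-yx : colour y x ≡ 0F
  colour-yx rewrite isX-≢ (≢-sym x≢y) | isX-x | isY-y = refl

  colour-x : p ≢ x → p ≢ y → colour x p ≡ 1F
  colour-x p≢x p≢y rewrite isX-x | isY-≢ x≢y | isY-≢ p≢y = refl

  colour-y : p ≢ x → p ≢ y → colour y p ≡ 2F
  colour-y p≢x p≢y rewrite isX-≢ (≢-sym x≢y) | isX-≢ p≢x | isY-y = refl

  colour-nearX : p ≢ x → p ≢ y → q ≢ x → q ≢ y → adj G x p ≡ true → colour p q ≡ 2F
  colour-nearX p≢x p≢y q≢x q≢y x~p rewrite isX-≢ p≢x | isX-≢ q≢x | isY-≢ p≢y | isY-≢ q≢y | x~p = refl

  colour-farX : p ≢ x → p ≢ y → q ≢ x → q ≢ y → adj G x p ≡ false → adj G x q ≡ false → colour p q ≡ 1F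
  colour-farX p≢x p≢y q≢x q≢y x≁p x≁q
    rewrite isX-≢ p≢x | isX-≢ q≢x | isY-≢ p≢y | isY-≢ q≢y | x≁p | x≁q = refl

  open LoosePaths colouring

  rainbow-xy : RainbowThrough x y
  rainbow-xy {p} {q} p≢x p≢y q≢x q≢y
    rewrite colour-sym p x | colour-x p≢x p≢y | colour-xy | colour-y q≢x q≢y = (λ ()) , (λ ()) , (λ ())

  rainbow-yx : RainbowThrough y x
  rainbow-yx {p} {q} p≢y p≢x q≢y q≢x
    rewrite colour-sym p y | colour-y p≢x p≢y | colour-yx | colour-x q≢x q≢y = (λ ()) , (λ ()) , (λ ())

module LooseTricolouring {n : ℕ} (G : Graph n) (connected : Connected G)
                         (noCutVertex : ∀ w → ConnectedWithout G w)
                         {x y : Fin n} (x~y : adj G x y ≡ true) where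

  open Walks G
  open TwoConnectedness connected noCutVertex
  open Tricolouring G x~y
  open LoosePaths colouring

  private
    variable
      u v : Fin n

  colours-differ : ∀ {α β α′ β′ : Fin 3} → α ≡ α′ → β ≡ β′ → α′ ≢ β′ → α ≢ β
  colours-differ refl refl α≢β = α≢β

  x≁⇒≢y : adj G x v ≡ false → v ≢ y
  x≁⇒≢y x≁y refl = contradiction (trans (sym x≁y) x~y) λ ()

  y≁⇒≢x : adj G y v ≡ false → v ≢ x
  y≁⇒≢x y≁x refl = contradiction (trans (sym y≁x) (edge-sym x~y)) λ ()

  -- Either x z v is loose, or the last edge zv of Q gets colour 1 and x Q sees all three colours.
  looseFromX-via : (Q : Walk G y v) → IsPath Q → x ∉ vertices Q → v ≢ x →
                   adj G x v ≡ false → adj G y v ≡ false → LoosePath x v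
  looseFromX-via (stop _) _ _ _ x≁y _ = contradiction (trans (sym x≁y) x~y) λ ()
  looseFromX-via {v} Q@(step {w = q} y~q Q′) Q! x∉Q v≢x x≁v y≁v with lastEdge y~q Q′
  ... | z , z~v , z∈Q , zv∈Q = via (adj G x z) refl
    where
    v≢y : v ≢ y
    v≢y = x≁⇒≢y x≁v
    z≢x : z ≢ x
    z≢x refl = x∉Q z∈Q
    z≢y : z ≢ y
    z≢y refl = contradiction (trans (sym y≁v) z~v) λ ()
    q≢x : q ≢ x
    q≢x refl = x∉Q (there (start∈vertices Q′))
    via : ∀ b → adj G x z ≡ b → LoosePath x v
    via true x~z = loosePath-twoEdges x~z z~v (≢-sym v≢x)
      (colours-differ (colour-x z≢x z≢y) (colour-nearX z≢x z≢y v≢x v≢y x~z) λ ())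
    via false x≁z = step x~y Q , IsPath-step x~y Q x∉Q Q! ,
      IsLooseColours-distinct (here (sym colour-xy))
        (there (subst (_∈ edgeColours colouring Q) (colour-farX z≢x z≢y v≢x v≢y x≁z x≁v) zv∈Q))
        (there (here (sym (colour-y q≢x (≢-sym (edge⇒≢ y~q))))))
        (λ ()) (λ ()) (λ ())

  looseFromX : v ≢ x → adj G x v ≡ false → LoosePath x v
  looseFromX {v} v≢x x≁v with adj G y v in y~v | noCutVertex x y v (≢-sym x≢y) v≢x
  ... | true  | _ = loosePath-twoEdges x~y y~v (≢-sym v≢x)
                      (colours-differ colour-xy (colour-y v≢x (x≁⇒≢y x≁v)) λ ())
  ... | false | Q , Q! , x∉Q = looseFromX-via Q Q! x∉Q v≢x x≁v y~v

  looseFromY : v ≢ y → adj G y v ≡ false → LoosePath y v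
  looseFromY {v} v≢y y≁v with adj G x v in x~v | noCutVertex y x v x≢y v≢y
  ... | true  | _ = loosePath-twoEdges (edge-sym x~y) x~v (≢-sym v≢y)
                      (colours-differ colour-yx (colour-x (y≁⇒≢x y≁v) v≢y) λ ())
  ... | false | stop _ , _ , _ = contradiction (trans (sym y≁v) (edge-sym x~y)) λ ()
  ... | false | step x~v′ (stop _) , _ , _ = contradiction (trans (sym x~v) x~v′) λ ()
  ... | false | P@(step {w = p} x~p (step {w = z} p~z P′)) , P! , y∉P =
    step (edge-sym x~y) P , IsPath-step (edge-sym x~y) P y∉P P! ,
    IsLooseColours-distinct (here (sym colour-yx)) (there (here (sym (colour-x p≢x p≢y))))
      (there (there (here (sym (colour-nearX p≢x p≢y z≢x z≢y x~p))))) (λ ()) (λ ()) (λ ())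
    where
    p≢x : p ≢ x
    p≢x = ≢-sym (edge⇒≢ x~p)
    p≢y : p ≢ y
    p≢y refl = y∉P (there (here refl))
    z≢x : z ≢ x
    z≢x refl = Unique[x∷xs]⇒x∉xs P! (there (start∈vertices P′))
    z≢y : z ≢ y
    z≢y refl = y∉P (there (there (start∈vertices P′)))

  looseAvoiding : u ≢ v → u ≢ x → u ≢ y → v ≢ x → v ≢ y → LoosePath u v
  looseAvoiding u≢v u≢x u≢y v≢x v≢y with twoDisjointPaths (≢-sym x≢y) u≢x (≢-sym u≢v)
  ... | inj₁ D = loosePath-link D x~y u≢x v≢y rainbow-xy
  ... | inj₂ D = loosePath-link D (edge-sym x~y) u≢y v≢x rainbow-yx

  loosePath : u ≢ v → LoosePath u v
  loosePath {u} {v} u≢v with adj G u v in u~v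
  ... | true = loosePath-edge u~v
  ... | false with u ≟ x | u ≟ y | v ≟ x | v ≟ y
  ...   | yes refl | _        | _        | _        = looseFromX (≢-sym u≢v) u~v
  ...   | no _     | yes refl | _        | _        = looseFromY (≢-sym u≢v) u~v
  ...   | no u≢x   | no _     | yes refl | _        = loosePath-reverse (looseFromX u≢x (trans (adj-sym G x u) u~v))
  ...   | no _     | no u≢y   | no _     | yes refl = loosePath-reverse (looseFromY u≢y (trans (adj-sym G y u) u~v))
  ...   | no u≢x   | no u≢y   | no v≢x   | no v≢y   = looseAvoiding u≢v u≢x u≢y v≢x v≢y

lemma6 : ∀ {n : ℕ} (G : Graph n) → TwoConnected G → LecAtMost G 3
lemma6 G (s≤s (s≤s (s≤s z≤n)) , connected , noCutVertex)
  with Walks.neighbour G (proj₁ (connected 0F 1F)) (λ ())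
... | y , 0~y = Tricolouring.colouring G 0~y , λ u v → LooseTricolouring.loosePath G connected noCutVertex 0~y
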